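{- Let $r,t$ be positive integers and $\gamma,\varepsilon>0$ reals with $\varepsilon^2>3r^2t^2\gamma$. There exists $n_0$ such that for all $n\ge n_0$ the following holds. Let $G$ be a graph containing no copy of $K_{r+1}(t)$, with a vertex partition $V(G)=U_1\cup\cdots\cup U_r$ such that $|U_i|\ge n$ for all $i\in[r]$ and $d(U_i,U_j)\ge 1-\gamma$ for all distinct $i,j\in[r]$. Let $X$ be the set of vertices $v\in V(G)$ with $|N(v)\cap U_i|\ge\varepsilon|U_i|$ for all $i\in[r]$. Then $|X|\le 2(t-1)\varepsilon^{ -rt}$.
   Context: $K_{r+1}(t)$ is the complete $(r+1)$-partite graph with $t$ vertices in each part. For disjoint vertex sets $A,B$, $d(A,B)=e_G(A,B)/(|A||B|)$, where $e_G(A,B)$ is the number of edges of $G$ with one end in $A$ and the other in $B$. $N(v)$ is the neighbourhood of $v$.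
   Formalization: The parameters γ and ε are taken as positive rationals instead of positive reals. -}

module Defs where

open import Data.Bool using (Bool; true; false; if_then_else_; _∧_)
open import Data.Nat using (ℕ; zero; suc)
import Data.Nat as ℕ
open import Data.Nat using () renaming (_+_ to _+ℕ_)
open import Data.Fin using (Fin; zero; suc)
import Data.Fin as Fin
open import Data.Product using (Σ; _×_; _,_)
open import Relation.Nullary using (¬_)
open import Relation.Nullary.Decidable using (⌊_⌋)
open import Relation.Binary.PropositionalEquality using (_≡_; _≢_)
open import Data.Integer using (+_)
open import Data.Rational using (_/_)
open import Data.Rational using (ℚ; _≤_; _*_; 1ℚ)
open import Data.Rational.Properties using (_≤?_)
open import Data.Fin.Properties using (all?)

record Graph : Set where
  field
    N    : ℕ
    adj  : Fin N → Fin N → Bool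
    sym  : ∀ u v → adj u v ≡ adj v u
    irr  : ∀ v → adj v v ≡ false
open Graph public

count : ∀ {n} → (Fin n → Bool) → ℕ
count {zero}  p = 0
count {suc n} p = (if p zero then 1 else 0) ℕ.+ count (λ i → p (suc i))

sumFin : ∀ {n} → (Fin n → ℕ) → ℕ
sumFin {zero}  f = 0
sumFin {suc n} f = f zero ℕ.+ sumFin (λ i → f (suc i))

_^ℚ_ : ℚ → ℕ → ℚ
q ^ℚ zero  = 1ℚ
q ^ℚ suc k = q * (q ^ℚ k)

module _ (G : Graph) {r : ℕ} (part : Fin (N G) → Fin r) where

  inU : Fin r → Fin (N G) → Bool
  inU i v = ⌊ part v Fin.≟ i ⌋

  sizeU : Fin r → ℕ
  sizeU i = count (inU i)

  -- e_G(U_i, U_j) (for i ≠ j the parts are disjoint)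
  eU : Fin r → Fin r → ℕ
  eU i j = sumFin (λ u → if inU i u then count (λ w → inU j w ∧ adj G u w) else 0)

  degU : Fin (N G) → Fin r → ℕ
  degU v i = count (λ w → inU i w ∧ adj G v w)

  inX : ℚ → Fin (N G) → Bool
  inX ε v = ⌊ all? (λ i → (ε * (+ sizeU i / 1)) ≤? (+ degU v i / 1)) ⌋

-- G contains a copy of K_{s}(t): s disjoint t-sets (an injective image of
-- Fin s × Fin t) with every pair of vertices in different parts adjacent.
ContainsKpart : Graph → ℕ → ℕ → Set
ContainsKpart G s t =
  Σ (Fin s → Fin t → Fin (N G)) λ f →
    (∀ i j a b → f i a ≡ f j b → (i ≡ j) × (a ≡ b)) ×
    (∀ i j a b → i ≢ j → adj G (f i a) (f j b) ≡ true)

{-# OPTIONS --safe #-}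
module Submission where

-- Write ε = p / q and γ = a / b and clear denominators, so that the whole argument is
-- arithmetic in ℕ. Give the positions of an (r t)-tuple of vertices the labels
-- (i , a) ∈ [r] × [t]; a tuple is compatible when entries with equal i are distinct and
-- entries with different i are adjacent, i.e. when it is a labelled copy of K_r(t).
-- For v ∈ X consider the tuples whose entries labelled i lie in N(v) ∩ U_i. A union bound
-- over the (r t)² pairs of positions shows that at most a fraction (r t)² γ / ε² < 1/3 of
-- them is incompatible (entries coincide rarely because |N(v) ∩ U_i| ≥ ε n is large), so
-- v is a common neighbour of at least (2/3) ε^(r t) ∏ |U_i| copies of K_r(t). No copy has
-- t common neighbours in X, since they would complete it to a K_{r+1}(t); counting the
-- pairs (v , copy) gives |X| (2/3) ε^(r t) ≤ t - 1.

open import Data.Bool using (Bool)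
open import Data.Nat using (ℕ)
open import Data.Fin using (Fin)
open import Defs using (Graph; N)

module Counting where

  open import Defs using (count; sumFin)
  open import Data.Bool using (true; false; if_then_else_; _∧_)
  open import Data.Nat hiding (_≟_)
  open import Data.Nat.Properties hiding (_≟_; suc-injective)
  open import Data.Fin using (Fin; zero; suc; lift)
  open import Data.Fin.Properties using (_≟_; suc-injective; lift-injective)
  open import Data.Product using (Σ; _×_; _,_)
  open import Data.Vec using (Vec; []; _∷_)
  open import Function using (_∘_)
  open import Function.Definitions using (Injective)
  open import Relation.Nullary using (does)
  open import Relation.Binary.PropositionalEquality
  open import Algebra.Properties.Semiring.Sum +-*-semiring public
    using (sum; sum-cong-≗; sum-replicate-zero; ∑-distrib-+; ∑-comm; *-distribˡ-sum; *-distribʳ-sum)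
  open ≡-Reasoning

  χ : Bool → ℕ
  χ b = if b then 1 else 0

  χ-∧ : ∀ a b → χ (a ∧ b) ≡ χ a * χ b
  χ-∧ true  b = sym (+-identityʳ (χ b))
  χ-∧ false b = refl

  χ≤1 : ∀ b → χ b ≤ 1
  χ≤1 true  = ≤-refl
  χ≤1 false = z≤n

  χ-∧-≤ : ∀ a b → χ (a ∧ b) ≤ χ a
  χ-∧-≤ true  b = χ≤1 b
  χ-∧-≤ false b = z≤n

  count≡sum : ∀ {n} (p : Fin n → Bool) → count p ≡ sum (χ ∘ p)
  count≡sum {zero}  p = refl
  count≡sum {suc n} p = cong (χ (p zero) +_) (count≡sum (p ∘ suc))

  sumFin≡sum : ∀ {n} (f : Fin n → ℕ) → sumFin f ≡ sum f
  sumFin≡sum {zero}  f = refl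
  sumFin≡sum {suc n} f = cong (f zero +_) (sumFin≡sum (f ∘ suc))

  sum-χ-≟ : ∀ {n} (y : Fin n) → sum (λ x → χ (does (x ≟ y))) ≡ 1
  sum-χ-≟ {suc n} zero    = cong suc (sum-replicate-zero n)
  sum-χ-≟ {suc n} (suc y) = sum-χ-≟ y

  ≤count⇒injection : ∀ {n} (p : Fin n → Bool) t → t ≤ count p →
    Σ (Fin t → Fin n) λ w → Injective _≡_ _≡_ w × (∀ a → p (w a) ≡ true)
  ≤count⇒injection p zero _ = (λ ()) , (λ { {()} }) , (λ ())
  ≤count⇒injection {suc n} p (suc t) t<count with p zero in p₀
  ... | true  = let w , w-inj , pw = ≤count⇒injection (p ∘ suc) t (s≤s⁻¹ t<count) in
    lift 1 w , lift-injective w w-inj 1 , λ where zero → p₀ ; (suc a) → pw a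
  ... | false = let w , w-inj , pw = ≤count⇒injection (p ∘ suc) (suc t) t<count in
    suc ∘ w , w-inj ∘ suc-injective , pw

  sum-mono-≤ : ∀ {n} {f g : Fin n → ℕ} → (∀ i → f i ≤ g i) → sum f ≤ sum g
  sum-mono-≤ {zero}  f≤g = z≤n
  sum-mono-≤ {suc n} f≤g = +-mono-≤ (f≤g zero) (sum-mono-≤ (f≤g ∘ suc))

  module _ {N : ℕ} where

    tupleSum : ∀ k → (Vec (Fin N) k → ℕ) → ℕ
    tupleSum zero    F = F []
    tupleSum (suc k) F = sum (λ x → tupleSum k (λ T → F (x ∷ T)))

    tupleSum-cong : ∀ k {F H : Vec (Fin N) k → ℕ} → (∀ T → F T ≡ H T) → tupleSum k F ≡ tupleSum k H
    tupleSum-cong zero    F≡H = F≡H []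
    tupleSum-cong (suc k) F≡H = sum-cong-≗ (λ x → tupleSum-cong k (λ T → F≡H (x ∷ T)))

    tupleSum-mono-≤ : ∀ k {F H : Vec (Fin N) k → ℕ} → (∀ T → F T ≤ H T) → tupleSum k F ≤ tupleSum k H
    tupleSum-mono-≤ zero    F≤H = F≤H []
    tupleSum-mono-≤ (suc k) F≤H = sum-mono-≤ (λ x → tupleSum-mono-≤ k (λ T → F≤H (x ∷ T)))

    tupleSum-distrib-+ : ∀ k (F H : Vec (Fin N) k → ℕ) →
      tupleSum k (λ T → F T + H T) ≡ tupleSum k F + tupleSum k H
    tupleSum-distrib-+ zero    F H = refl
    tupleSum-distrib-+ (suc k) F H = trans
      (sum-cong-≗ (λ x → tupleSum-distrib-+ k (λ T → F (x ∷ T)) (λ T → H (x ∷ T))))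
      (∑-distrib-+ {N} _ _)

    *-distribˡ-tupleSum : ∀ k c (F : Vec (Fin N) k → ℕ) → c * tupleSum k F ≡ tupleSum k (λ T → c * F T)
    *-distribˡ-tupleSum zero    c F = refl
    *-distribˡ-tupleSum (suc k) c F = trans (*-distribˡ-sum {N} c _)
      (sum-cong-≗ (λ x → *-distribˡ-tupleSum k c (λ T → F (x ∷ T))))

    tupleSum-sum-comm : ∀ k (F : Fin N → Vec (Fin N) k → ℕ) →
      tupleSum k (λ T → sum (λ x → F x T)) ≡ sum (λ x → tupleSum k (F x))
    tupleSum-sum-comm zero    F = refl
    tupleSum-sum-comm (suc k) F = trans
      (sum-cong-≗ (λ y → tupleSum-sum-comm k (λ x T → F x (y ∷ T))))
      (∑-comm (λ y x → tupleSum k (λ T → F x (y ∷ T))))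

    sum-*-tupleSum : ∀ k (f : Fin N → ℕ) (F : Vec (Fin N) k → ℕ) →
      sum (λ x → tupleSum k (λ T → f x * F T)) ≡ sum f * tupleSum k F
    sum-*-tupleSum k f F = begin
      sum (λ x → tupleSum k (λ T → f x * F T)) ≡⟨ sum-cong-≗ (λ x → *-distribˡ-tupleSum k (f x) F) ⟨
      sum (λ x → f x * tupleSum k F)          ≡⟨ *-distribʳ-sum (tupleSum k F) f ⟨
      sum f * tupleSum k F                    ∎

    sum-tupleSum-distrib-+ : ∀ k (F H : Fin N → Vec (Fin N) k → ℕ) →
      sum (λ x → tupleSum k (λ T → F x T + H x T)) ≡ sum (λ x → tupleSum k (F x)) + sum (λ x → tupleSum k (H x))
    sum-tupleSum-distrib-+ k F H =
      trans (sum-cong-≗ {N} (λ x → tupleSum-distrib-+ k (F x) (H x))) (∑-distrib-+ {N} _ _)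

    module _ {Λ : Set} where

      entrywise : (Λ → Fin N → ℕ) → ∀ {k} → Vec Λ k → Vec (Fin N) k → ℕ
      entrywise g []      []      = 0
      entrywise g (ℓ ∷ L) (x ∷ T) = g ℓ x + entrywise g L T

      sum-entrywise : ∀ (f : Fin N → ℕ) (g : Fin N → Λ → Fin N → ℕ) {k} (L : Vec Λ k) T →
        sum (λ x → f x * entrywise (g x) L T) ≡ entrywise (λ ℓ y → sum (λ x → f x * g x ℓ y)) L T
      sum-entrywise f g [] [] = trans (sym (*-distribʳ-sum 0 f)) (*-zeroʳ (sum f))
      sum-entrywise f g (ℓ ∷ L) (y ∷ T) = begin
        sum (λ x → f x * (g x ℓ y + entrywise (g x) L T))
          ≡⟨ sum-cong-≗ (λ x → *-distribˡ-+ (f x) _ _) ⟩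
        sum (λ x → f x * g x ℓ y + f x * entrywise (g x) L T)
          ≡⟨ ∑-distrib-+ {N} _ _ ⟩
        sum (λ x → f x * g x ℓ y) + sum (λ x → f x * entrywise (g x) L T)
          ≡⟨ cong (sum (λ x → f x * g x ℓ y) +_) (sum-entrywise f g L T) ⟩
        sum (λ x → f x * g x ℓ y) + entrywise (λ ℓ′ y′ → sum (λ x → f x * g x ℓ′ y′)) L T ∎

module Boxes {N : ℕ} {Λ : Set} (A : Λ → Fin N → Bool) where

  open Counting
  open import Data.Bool using (true; _∧_)
  open import Data.Nat
  open import Data.Nat.Properties
  open import Data.Nat.Tactic.RingSolver using (solve-∀)
  open import Data.Bool.Properties using (∧-conicalˡ; ∧-conicalʳ)
  open import Data.Fin using (Fin; zero; suc)
  open import Data.Vec using (Vec; []; _∷_; lookup)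
  open import Function using (_∘_)
  open import Relation.Binary.PropositionalEquality

  inBox : ∀ {k} → Vec Λ k → Vec (Fin N) k → Bool
  inBox []      []      = true
  inBox (ℓ ∷ L) (x ∷ T) = A ℓ x ∧ inBox L T

  size : Λ → ℕ
  size ℓ = sum (χ ∘ A ℓ)

  boxSize : ∀ {k} → Vec Λ k → ℕ
  boxSize []      = 1
  boxSize (ℓ ∷ L) = size ℓ * boxSize L

  tupleSum-χ-inBox : ∀ {k} (L : Vec Λ k) → tupleSum k (χ ∘ inBox L) ≡ boxSize L
  tupleSum-χ-inBox []              = refl
  tupleSum-χ-inBox {suc k} (ℓ ∷ L) = begin
    sum (λ x → tupleSum k (λ T → χ (A ℓ x ∧ inBox L T)))
      ≡⟨ sum-cong-≗ (λ x → tupleSum-cong k (λ T → χ-∧ (A ℓ x) (inBox L T))) ⟩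
    sum (λ x → tupleSum k (λ T → χ (A ℓ x) * χ (inBox L T)))
      ≡⟨ sum-*-tupleSum k (χ ∘ A ℓ) (χ ∘ inBox L) ⟩
    size ℓ * tupleSum k (χ ∘ inBox L)
      ≡⟨ cong (size ℓ *_) (tupleSum-χ-inBox L) ⟩
    size ℓ * boxSize L ∎
    where open ≡-Reasoning

  inBox-lookup : ∀ {k} (L : Vec Λ k) T → inBox L T ≡ true → ∀ m → A (lookup L m) (lookup T m) ≡ true
  inBox-lookup (ℓ ∷ L) (x ∷ T) in∏ zero    = ∧-conicalˡ (A ℓ x) (inBox L T) in∏
  inBox-lookup (ℓ ∷ L) (x ∷ T) in∏ (suc m) = inBox-lookup L T (∧-conicalʳ (A ℓ x) (inBox L T) in∏) m

  boxSize-positive : (∀ ℓ → 1 ≤ size ℓ) → ∀ {k} (L : Vec Λ k) → 1 ≤ boxSize L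
  boxSize-positive size-positive []      = ≤-refl
  boxSize-positive size-positive (ℓ ∷ L) = *-mono-≤ (size-positive ℓ) (boxSize-positive size-positive L)

  tupleSum-inBox-cons : ∀ ℓ {k} (L : Vec Λ k) (h : Fin N → Vec (Fin N) k → ℕ) (H : Vec (Fin N) k → ℕ) →
    sum (λ x → tupleSum k (λ T → χ (A ℓ x ∧ inBox L T) * (h x T + H T)))
      ≡ sum (λ x → tupleSum k (λ T → χ (A ℓ x) * (χ (inBox L T) * h x T)))
        + size ℓ * tupleSum k (λ T → χ (inBox L T) * H T)
  tupleSum-inBox-cons ℓ {k} L h H = begin
    sum (λ x → tupleSum k (λ T → χ (A ℓ x ∧ inBox L T) * (h x T + H T)))
      ≡⟨ sum-cong-≗ (λ x → tupleSum-cong k (λ T → distribute x T)) ⟩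
    sum (λ x → tupleSum k (λ T → χ (A ℓ x) * (χ (inBox L T) * h x T) + χ (A ℓ x) * (χ (inBox L T) * H T)))
      ≡⟨ sum-tupleSum-distrib-+ k (λ x T → χ (A ℓ x) * (χ (inBox L T) * h x T))
                                  (λ x T → χ (A ℓ x) * (χ (inBox L T) * H T)) ⟩
    sum (λ x → tupleSum k (λ T → χ (A ℓ x) * (χ (inBox L T) * h x T)))
      + sum (λ x → tupleSum k (λ T → χ (A ℓ x) * (χ (inBox L T) * H T)))
      ≡⟨ cong (_ +_) (sum-*-tupleSum k (χ ∘ A ℓ) (λ T → χ (inBox L T) * H T)) ⟩
    sum (λ x → tupleSum k (λ T → χ (A ℓ x) * (χ (inBox L T) * h x T)))
      + size ℓ * tupleSum k (λ T → χ (inBox L T) * H T) ∎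
    where
    open ≡-Reasoning
    distribute : ∀ x T → χ (A ℓ x ∧ inBox L T) * (h x T + H T)
                       ≡ χ (A ℓ x) * (χ (inBox L T) * h x T) + χ (A ℓ x) * (χ (inBox L T) * H T)
    distribute x T rewrite χ-∧ (A ℓ x) (inBox L T) = ring (χ (A ℓ x)) (χ (inBox L T)) (h x T) (H T)
      where
      ring : ∀ a b u v → a * b * (u + v) ≡ a * (b * u) + a * (b * v)
      ring = solve-∀

  tupleSum-entrywise-≤ : ∀ (g : Λ → Fin N → ℕ) D C →
    (∀ ℓ → D * sum (λ y → χ (A ℓ y) * g ℓ y) ≤ C * size ℓ) →
    ∀ {k} (L : Vec Λ k) → D * tupleSum k (λ T → χ (inBox L T) * entrywise g L T) ≤ k * C * boxSize L
  tupleSum-entrywise-≤ g D C bound []              = ≤-reflexive (*-zeroʳ D)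
  tupleSum-entrywise-≤ g D C bound {suc k} (ℓ ∷ L) = begin
    D * sum (λ y → tupleSum k (λ T → χ (A ℓ y ∧ inBox L T) * (g ℓ y + entrywise g L T)))
      ≡⟨ cong (D *_) (tupleSum-inBox-cons ℓ L (λ y _ → g ℓ y) (entrywise g L)) ⟩
    D * (sum (λ y → tupleSum k (λ T → χ (A ℓ y) * (χ (inBox L T) * g ℓ y))) + size ℓ * tupleSum k S)
      ≡⟨ cong (λ e → D * (e + size ℓ * tupleSum k S)) first-term ⟩
    D * (sum (λ y → χ (A ℓ y) * g ℓ y) * boxSize L + size ℓ * tupleSum k S)
      ≡⟨ regroup D (sum (λ y → χ (A ℓ y) * g ℓ y)) (boxSize L) (size ℓ) (tupleSum k S) ⟩
    D * sum (λ y → χ (A ℓ y) * g ℓ y) * boxSize L + size ℓ * (D * tupleSum k S)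
      ≤⟨ +-mono-≤ (*-monoˡ-≤ (boxSize L) (bound ℓ))
                  (*-monoʳ-≤ (size ℓ) (tupleSum-entrywise-≤ g D C bound L)) ⟩
    C * size ℓ * boxSize L + size ℓ * (k * C * boxSize L)
      ≡⟨ collect C (size ℓ) (boxSize L) k ⟩
    suc k * C * (size ℓ * boxSize L) ∎
    where
    open ≤-Reasoning
    S : Vec (Fin N) k → ℕ
    S T = χ (inBox L T) * entrywise g L T
    first-term : sum (λ y → tupleSum k (λ T → χ (A ℓ y) * (χ (inBox L T) * g ℓ y)))
               ≡ sum (λ y → χ (A ℓ y) * g ℓ y) * boxSize L
    first-term = trans (sum-cong-≗ (λ y → tupleSum-cong k (λ T → swap (χ (A ℓ y)) (χ (inBox L T)) (g ℓ y))))
                       (trans (sum-*-tupleSum k (λ y → χ (A ℓ y) * g ℓ y) (χ ∘ inBox L))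
                              (cong (sum (λ y → χ (A ℓ y) * g ℓ y) *_) (tupleSum-χ-inBox L)))
      where
      swap : ∀ a b u → a * (b * u) ≡ a * u * b
      swap = solve-∀
    regroup : ∀ D G P s S → D * (G * P + s * S) ≡ D * G * P + s * (D * S)
    regroup = solve-∀
    collect : ∀ C s P k → C * s * P + s * (k * C * P) ≡ suc k * C * (s * P)
    collect = solve-∀

module BoxComparison {N : ℕ} {Λ : Set} (A B : Λ → Fin N → Bool) where

  open import Data.Bool using (_∧_; true)
  open import Data.Bool.Properties using (∧-conicalˡ; ∧-conicalʳ)
  open import Data.Nat
  open import Data.Nat.Properties
  open import Data.Nat.Tactic.RingSolver using (solve-∀)
  open import Data.Vec using (Vec; []; _∷_)
  open import Relation.Binary.PropositionalEquality
  private
    module A = Boxes A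
    module B = Boxes B

  inBox-mono : (∀ ℓ x → A ℓ x ≡ true → B ℓ x ≡ true) →
    ∀ {k} (L : Vec Λ k) T → A.inBox L T ≡ true → B.inBox L T ≡ true
  inBox-mono A⊆B []      []      _   = refl
  inBox-mono A⊆B (ℓ ∷ L) (x ∷ T) in∏ = cong₂ _∧_
    (A⊆B ℓ x (∧-conicalˡ (A ℓ x) (A.inBox L T) in∏))
    (inBox-mono A⊆B L T (∧-conicalʳ (A ℓ x) (A.inBox L T) in∏))

  ^*boxSize-mono-≤ : ∀ p q → (∀ ℓ → p * A.size ℓ ≤ q * B.size ℓ) →
    ∀ {k} (L : Vec Λ k) → p ^ k * A.boxSize L ≤ q ^ k * B.boxSize L
  ^*boxSize-mono-≤ p q A≤B []              = ≤-refl
  ^*boxSize-mono-≤ p q A≤B {suc k} (ℓ ∷ L) = begin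
    p * p ^ k * (A.size ℓ * A.boxSize L)   ≡⟨ interchange p (p ^ k) (A.size ℓ) (A.boxSize L) ⟩
    (p * A.size ℓ) * (p ^ k * A.boxSize L) ≤⟨ *-mono-≤ (A≤B ℓ) (^*boxSize-mono-≤ p q A≤B L) ⟩
    (q * B.size ℓ) * (q ^ k * B.boxSize L) ≡⟨ interchange q (q ^ k) (B.size ℓ) (B.boxSize L) ⟨
    q * q ^ k * (B.size ℓ * B.boxSize L)   ∎
    where
    open ≤-Reasoning
    interchange : ∀ a b c d → a * b * (c * d) ≡ (a * c) * (b * d)
    interchange = solve-∀

module CompatibleTuples {N : ℕ} {Λ : Set} (compatible : Λ → Fin N → Λ → Fin N → Bool) where

  open Counting
  open import Data.Bool using (true; false; _∧_; not)
  open import Data.Bool.Properties using (∧-conicalˡ; ∧-conicalʳ)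
  open import Data.Nat
  open import Data.Nat.Properties
  open import Data.Nat.Tactic.RingSolver using (solve-∀)
  open import Data.Fin using (Fin; zero; suc)
  open import Data.Vec using (Vec; []; _∷_; lookup)
  open import Function using (_∘_)
  open import Relation.Nullary using (contradiction)
  open import Relation.Binary.PropositionalEquality

  compatibleWithAll : Λ → Fin N → ∀ {k} → Vec Λ k → Vec (Fin N) k → Bool
  compatibleWithAll ℓ x []       []      = true
  compatibleWithAll ℓ x (ℓ′ ∷ L) (y ∷ T) = compatible ℓ x ℓ′ y ∧ compatibleWithAll ℓ x L T

  pairwiseCompatible : ∀ {k} → Vec Λ k → Vec (Fin N) k → Bool
  pairwiseCompatible []      []      = true
  pairwiseCompatible (ℓ ∷ L) (x ∷ T) = compatibleWithAll ℓ x L T ∧ pairwiseCompatible L T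

  conflicts : Λ → Fin N → ∀ {k} → Vec Λ k → Vec (Fin N) k → ℕ
  conflicts ℓ x = entrywise (λ ℓ′ y → χ (not (compatible ℓ x ℓ′ y)))

  incompatiblePairs : ∀ {k} → Vec Λ k → Vec (Fin N) k → ℕ
  incompatiblePairs []      []      = 0
  incompatiblePairs (ℓ ∷ L) (x ∷ T) = conflicts ℓ x L T + incompatiblePairs L T

  private
    χ-not-∧ : ∀ a b → χ (not (a ∧ b)) ≤ χ (not a) + χ (not b)
    χ-not-∧ true  b = ≤-refl
    χ-not-∧ false b = s≤s z≤n

  χ-not-compatibleWithAll : ∀ ℓ x {k} (L : Vec Λ k) T →
    χ (not (compatibleWithAll ℓ x L T)) ≤ conflicts ℓ x L T
  χ-not-compatibleWithAll ℓ x []       []      = z≤n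
  χ-not-compatibleWithAll ℓ x (ℓ′ ∷ L) (y ∷ T) =
    ≤-trans (χ-not-∧ (compatible ℓ x ℓ′ y) _) (+-monoʳ-≤ _ (χ-not-compatibleWithAll ℓ x L T))

  χ-not-pairwiseCompatible : ∀ {k} (L : Vec Λ k) T → χ (not (pairwiseCompatible L T)) ≤ incompatiblePairs L T
  χ-not-pairwiseCompatible []      []      = z≤n
  χ-not-pairwiseCompatible (ℓ ∷ L) (x ∷ T) =
    ≤-trans (χ-not-∧ (compatibleWithAll ℓ x L T) _)
            (+-mono-≤ (χ-not-compatibleWithAll ℓ x L T) (χ-not-pairwiseCompatible L T))

  compatibleWithAll-lookup : ∀ ℓ x {k} (L : Vec Λ k) T → compatibleWithAll ℓ x L T ≡ true →
    ∀ m → compatible ℓ x (lookup L m) (lookup T m) ≡ true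
  compatibleWithAll-lookup ℓ x (ℓ′ ∷ L) (y ∷ T) all zero    =
    ∧-conicalˡ _ (compatibleWithAll ℓ x L T) all
  compatibleWithAll-lookup ℓ x (ℓ′ ∷ L) (y ∷ T) all (suc m) =
    compatibleWithAll-lookup ℓ x L T (∧-conicalʳ (compatible ℓ x ℓ′ y) _ all) m

  pairwiseCompatible-lookup : (∀ ℓ x ℓ′ y → compatible ℓ x ℓ′ y ≡ compatible ℓ′ y ℓ x) →
    ∀ {k} (L : Vec Λ k) T → pairwiseCompatible L T ≡ true →
    ∀ m m′ → m ≢ m′ → compatible (lookup L m) (lookup T m) (lookup L m′) (lookup T m′) ≡ true
  pairwiseCompatible-lookup sym-compatible (ℓ ∷ L) (x ∷ T) pc zero zero m≢m′ = contradiction refl m≢m′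
  pairwiseCompatible-lookup sym-compatible (ℓ ∷ L) (x ∷ T) pc zero (suc m′) _ =
    compatibleWithAll-lookup ℓ x L T (∧-conicalˡ _ (pairwiseCompatible L T) pc) m′
  pairwiseCompatible-lookup sym-compatible (ℓ ∷ L) (x ∷ T) pc (suc m) zero _ =
    trans (sym-compatible _ _ ℓ x) (compatibleWithAll-lookup ℓ x L T (∧-conicalˡ _ (pairwiseCompatible L T) pc) m)
  pairwiseCompatible-lookup sym-compatible (ℓ ∷ L) (x ∷ T) pc (suc m) (suc m′) m≢m′ =
    pairwiseCompatible-lookup sym-compatible L T (∧-conicalʳ (compatibleWithAll ℓ x L T) _ pc) m m′
      (m≢m′ ∘ cong suc)

  module _ (A : Λ → Fin N → Bool) where

    open Boxes A

    badPairs : Λ → Λ → Fin N → ℕ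
    badPairs ℓ ℓ′ y = sum (λ x → χ (A ℓ x) * χ (not (compatible ℓ x ℓ′ y)))

    FewBadPairs : ℕ → ℕ → Set
    FewBadPairs D c = ∀ ℓ ℓ′ → D * sum (λ y → χ (A ℓ′ y) * badPairs ℓ ℓ′ y) ≤ c * size ℓ * size ℓ′

    compatibleCount : ∀ {k} → Vec Λ k → ℕ
    compatibleCount {k} L = tupleSum k (λ T → χ (inBox L T ∧ pairwiseCompatible L T))

    sum-tupleSum-conflicts : ∀ ℓ {k} (L : Vec Λ k) →
      sum (λ x → tupleSum k (λ T → χ (A ℓ x) * (χ (inBox L T) * conflicts ℓ x L T)))
        ≡ tupleSum k (λ T → χ (inBox L T) * entrywise (badPairs ℓ) L T)
    sum-tupleSum-conflicts ℓ {k} L = begin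
      sum (λ x → tupleSum k (λ T → χ (A ℓ x) * (χ (inBox L T) * conflicts ℓ x L T)))
        ≡⟨ tupleSum-sum-comm k _ ⟨
      tupleSum k (λ T → sum (λ x → χ (A ℓ x) * (χ (inBox L T) * conflicts ℓ x L T)))
        ≡⟨ tupleSum-cong k (λ T → trans (sum-cong-≗ (λ x → *-comm-middle (χ (A ℓ x)) (χ (inBox L T)) _))
                                         (sym (*-distribˡ-sum (χ (inBox L T)) (λ x → χ (A ℓ x) * conflicts ℓ x L T)))) ⟩
      tupleSum k (λ T → χ (inBox L T) * sum (λ x → χ (A ℓ x) * conflicts ℓ x L T))
        ≡⟨ tupleSum-cong k (λ T → cong (χ (inBox L T) *_) (sum-entrywise (χ ∘ A ℓ) _ L T)) ⟩
      tupleSum k (λ T → χ (inBox L T) * entrywise (badPairs ℓ) L T) ∎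
      where
      open ≡-Reasoning
      *-comm-middle : ∀ a b c → a * (b * c) ≡ b * (a * c)
      *-comm-middle = solve-∀

    tupleSum-incompatiblePairs-≤ : ∀ D c → FewBadPairs D c → ∀ {k} (L : Vec Λ k) →
      D * tupleSum k (λ T → χ (inBox L T) * incompatiblePairs L T) ≤ k * k * c * boxSize L
    tupleSum-incompatiblePairs-≤ D c few []              = ≤-reflexive (*-zeroʳ D)
    tupleSum-incompatiblePairs-≤ D c few {suc k} (ℓ ∷ L) = begin
      D * sum (λ x → tupleSum k (λ T → χ (A ℓ x ∧ inBox L T) * (conflicts ℓ x L T + incompatiblePairs L T)))
        ≡⟨ cong (D *_) (trans (tupleSum-inBox-cons ℓ L (λ x → conflicts ℓ x L) (incompatiblePairs L))
                              (cong (_+ size ℓ * tupleSum k P) (sum-tupleSum-conflicts ℓ L))) ⟩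
      D * (tupleSum k (λ T → χ (inBox L T) * entrywise (badPairs ℓ) L T) + size ℓ * tupleSum k P)
        ≡⟨ regroup D _ (size ℓ) (tupleSum k P) ⟩
      D * tupleSum k (λ T → χ (inBox L T) * entrywise (badPairs ℓ) L T) + size ℓ * (D * tupleSum k P)
        ≤⟨ +-mono-≤ (tupleSum-entrywise-≤ (badPairs ℓ) D (c * size ℓ) (few ℓ) L)
                    (*-monoʳ-≤ (size ℓ) (tupleSum-incompatiblePairs-≤ D c few L)) ⟩
      k * (c * size ℓ) * boxSize L + size ℓ * (k * k * c * boxSize L)
        ≤⟨ m≤m+n _ (suc k * (c * size ℓ * boxSize L)) ⟩
      k * (c * size ℓ) * boxSize L + size ℓ * (k * k * c * boxSize L) + suc k * (c * size ℓ * boxSize L)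
        ≡⟨ collect k c (size ℓ) (boxSize L) ⟩
      suc k * suc k * c * (size ℓ * boxSize L) ∎
      where
      open ≤-Reasoning
      P : Vec (Fin N) k → ℕ
      P T = χ (inBox L T) * incompatiblePairs L T
      regroup : ∀ D X s S → D * (X + s * S) ≡ D * X + s * (D * S)
      regroup = solve-∀
      collect : ∀ k c s P → k * (c * s) * P + s * (k * k * c * P) + suc k * (c * s * P)
                          ≡ suc k * suc k * c * (s * P)
      collect = solve-∀

    boxSize≤compatibleCount+ : ∀ D c → FewBadPairs D c →
      ∀ {k} (L : Vec Λ k) → D * boxSize L ≤ D * compatibleCount L + k * k * c * boxSize L
    boxSize≤compatibleCount+ D c few {k} L = begin
      D * boxSize L
        ≡⟨ cong (D *_) (tupleSum-χ-inBox L) ⟨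
      D * tupleSum k (χ ∘ inBox L)
        ≤⟨ *-monoʳ-≤ D (tupleSum-mono-≤ k (λ T →
             χ-split (inBox L T) (pairwiseCompatible L T) _ (χ-not-pairwiseCompatible L T))) ⟩
      D * tupleSum k (λ T → χ (inBox L T ∧ pairwiseCompatible L T) + χ (inBox L T) * incompatiblePairs L T)
        ≡⟨ trans (cong (D *_) (tupleSum-distrib-+ k _ _)) (*-distribˡ-+ D _ _) ⟩
      D * compatibleCount L + D * tupleSum k (λ T → χ (inBox L T) * incompatiblePairs L T)
        ≤⟨ +-monoʳ-≤ _ (tupleSum-incompatiblePairs-≤ D c few L) ⟩
      D * compatibleCount L + k * k * c * boxSize L ∎
      where
      open ≤-Reasoning
      χ-split : ∀ a g n → χ (not g) ≤ n → χ a ≤ χ (a ∧ g) + χ a * n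
      χ-split false g     n _   = z≤n
      χ-split true  true  n _   = m≤m+n 1 _
      χ-split true  false n 1≤n = ≤-trans 1≤n (≤-reflexive (sym (+-identityʳ n)))

    2*boxSize≤3*compatibleCount : ∀ D c .{{_ : NonZero D}} → FewBadPairs D c →
      ∀ {k} (L : Vec Λ k) → 3 * (k * k * c) ≤ D → 2 * boxSize L ≤ 3 * compatibleCount L
    2*boxSize≤3*compatibleCount D c few {k} L 3k²c≤D =
      *-cancelˡ-≤ D (+-cancelʳ-≤ (D * P) _ _ (begin
        D * (2 * P) + D * P                 ≡⟨ triple D P ⟩
        3 * (D * P)                         ≤⟨ *-monoʳ-≤ 3 (boxSize≤compatibleCount+ D c few L) ⟩
        3 * (D * g + k * k * c * P)         ≡⟨ spread D g (k * k * c) P ⟩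
        D * (3 * g) + 3 * (k * k * c) * P   ≤⟨ +-monoʳ-≤ (D * (3 * g)) (*-monoˡ-≤ P 3k²c≤D) ⟩
        D * (3 * g) + D * P                 ∎))
      where
      open ≤-Reasoning
      P = boxSize L
      g = compatibleCount L
      triple : ∀ D P → D * (2 * P) + D * P ≡ 3 * (D * P)
      triple = solve-∀
      spread : ∀ D g e P → 3 * (D * g + e * P) ≡ D * (3 * g) + 3 * e * P
      spread = solve-∀

module GraphTuples (G : Graph) {r : ℕ} (part : Fin (N G) → Fin r) where

  open Counting
  open import Defs using (adj; irr; inU; sizeU; degU; eU; count; ContainsKpart)
  open import Data.Bool using (true; false; if_then_else_; _∧_; not)
  open import Data.Bool.Properties using (∧-conicalˡ; ∧-conicalʳ; not-involutive)
  open import Data.Nat hiding (_≟_)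
  open import Data.Nat.Properties hiding (_≟_; suc-injective)
  open import Data.Nat.Tactic.RingSolver using (solve-∀)
  open import Data.Fin using (Fin; zero; suc; combine; remQuot; splitAt; join)
  open import Data.Fin.Properties using (_≟_; combine-injective; remQuot-combine; join-splitAt)
  open import Data.Product using (_×_; _,_; proj₁)
  open import Data.Sum using (_⊎_; inj₁; inj₂)
  open import Data.Vec using (Vec; lookup; tabulate)
  open import Data.Vec.Properties using (lookup∘tabulate)
  open import Function using (_∘_; case_of_)
  open import Function.Definitions using (Injective)
  open import Relation.Nullary using (¬_; does; yes; no; contradiction)
  open import Relation.Nullary.Decidable using (dec-true; dec-false)
  open import Relation.Binary.PropositionalEquality

  V : Set
  V = Fin (N G)

  compatible : Fin r → V → Fin r → V → Bool
  compatible i x j y = if does (i ≟ j) then not (does (x ≟ y)) else adj G x y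

  open CompatibleTuples compatible public
  open BoxComparison using (inBox-mono; ^*boxSize-mono-≤)

  compatible-same : ∀ i x y → compatible i x i y ≡ not (does (x ≟ y))
  compatible-same i x y = cong (if_then not (does (x ≟ y)) else adj G x y) (dec-true (i ≟ i) refl)

  compatible-different : ∀ {i j} x y → i ≢ j → compatible i x j y ≡ adj G x y
  compatible-different {i} {j} x y i≢j = cong (if_then not (does (x ≟ y)) else adj G x y) (dec-false (i ≟ j) i≢j)

  does-≟-sym : ∀ {n} (i j : Fin n) → does (i ≟ j) ≡ does (j ≟ i)
  does-≟-sym i j with i ≟ j
  ... | yes i≡j = sym (dec-true (j ≟ i) (sym i≡j))
  ... | no  i≢j = sym (dec-false (j ≟ i) (i≢j ∘ sym))

  compatible-sym : ∀ i x j y → compatible i x j y ≡ compatible j y i x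
  compatible-sym i x j y rewrite does-≟-sym i j | does-≟-sym x y | Graph.sym G x y = refl

  adj⇒≢ : ∀ {x y} → adj G x y ≡ true → x ≢ y
  adj⇒≢ {x} xy refl with () ← trans (sym xy) (irr G x)

  compatible⇒≢ : ∀ i x j y → compatible i x j y ≡ true → x ≢ y
  compatible⇒≢ i x j .x c refl with i ≟ j
  ... | yes refl with () ← trans (sym c) (cong not (dec-true (x ≟ x) refl))
  ... | no  _    = adj⇒≢ c refl

  -- Position combine i a of an (r * t)-tuple is the a-th vertex of the i-th class of K_r(t).
  labels : ∀ t → Vec (Fin r) (r * t)
  labels t = tabulate (proj₁ ∘ remQuot t)

  lookup-labels : ∀ {t} i (a : Fin t) → lookup (labels t) (combine i a) ≡ i
  lookup-labels {t} i a = trans (lookup∘tabulate _ (combine i a)) (cong proj₁ (remQuot-combine i a))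

  common-neighbours⇒Kpart : ∀ {t} (T : Vec V (r * t)) → pairwiseCompatible (labels t) T ≡ true →
    (w : Fin t → V) → Injective _≡_ _≡_ w → (∀ a m → adj G (w a) (lookup T m) ≡ true) →
    ContainsKpart G (r + 1) t
  common-neighbours⇒Kpart {t} T T-compatible w w-injective w-adjacent =
    (λ i → vertex (splitAt r i)) ,
    (λ i j a b e → let s≡s′ , a≡b = vertex-injective (splitAt r i) (splitAt r j) a b e
                   in splitAt-injective s≡s′ , a≡b) ,
    (λ i j a b i≢j → vertex-adjacent (splitAt r i) (splitAt r j) a b (i≢j ∘ splitAt-injective))
    where
    vertex : Fin r ⊎ Fin 1 → Fin t → V
    vertex (inj₁ i) a = lookup T (combine i a)
    vertex (inj₂ _) a = w a

    splitAt-injective : ∀ {i j} → splitAt r {1} i ≡ splitAt r j → i ≡ j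
    splitAt-injective {i} {j} s≡s′ =
      trans (sym (join-splitAt r 1 i)) (trans (cong (join r 1) s≡s′) (join-splitAt r 1 j))

    T-compatible-at : ∀ i a j b → combine i a ≢ combine j b →
      compatible i (vertex (inj₁ i) a) j (vertex (inj₁ j) b) ≡ true
    T-compatible-at i a j b ne =
      subst₂ (λ i′ j′ → compatible i′ (vertex (inj₁ i) a) j′ (vertex (inj₁ j) b) ≡ true)
        (lookup-labels i a) (lookup-labels j b)
        (pairwiseCompatible-lookup compatible-sym (labels t) T T-compatible (combine i a) (combine j b) ne)

    w-adjacent′ : ∀ b m → adj G (lookup T m) (w b) ≡ true
    w-adjacent′ b m = trans (Graph.sym G (lookup T m) (w b)) (w-adjacent b m)

    vertex-injective : ∀ s s′ a b → vertex s a ≡ vertex s′ b → s ≡ s′ × a ≡ b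
    vertex-injective (inj₁ i) (inj₁ j) a b e with combine i a ≟ combine j b
    ... | yes c≡c′ = let i≡j , a≡b = combine-injective i a j b c≡c′ in cong inj₁ i≡j , a≡b
    ... | no  c≢c′ = contradiction e (compatible⇒≢ i _ j _ (T-compatible-at i a j b c≢c′))
    vertex-injective (inj₁ i)    (inj₂ _)    a b e = contradiction e (adj⇒≢ (w-adjacent′ b (combine i a)))
    vertex-injective (inj₂ _)    (inj₁ j)    a b e = contradiction e (adj⇒≢ (w-adjacent a (combine j b)))
    vertex-injective (inj₂ zero) (inj₂ zero) a b e = refl , w-injective e

    vertex-adjacent : ∀ s s′ a b → s ≢ s′ → adj G (vertex s a) (vertex s′ b) ≡ true
    vertex-adjacent (inj₁ i) (inj₁ j) a b s≢s′ =
      trans (sym (compatible-different (lookup T (combine i a)) (lookup T (combine j b)) i≢j))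
            (T-compatible-at i a j b (i≢j ∘ proj₁ ∘ combine-injective i a j b))
      where
      i≢j : i ≢ j
      i≢j = s≢s′ ∘ cong inj₁
    vertex-adjacent (inj₁ i)    (inj₂ _)    a b _    = w-adjacent′ b (combine i a)
    vertex-adjacent (inj₂ _)    (inj₁ j)    a b _    = w-adjacent a (combine j b)
    vertex-adjacent (inj₂ zero) (inj₂ zero) a b s≢s′ = contradiction refl s≢s′

  neighbourIn : V → Fin r → V → Bool
  neighbourIn v i x = inU G part i x ∧ adj G v x

  size-neighbourIn : ∀ v i → Boxes.size (neighbourIn v) i ≡ degU G part v i
  size-neighbourIn v i = sym (count≡sum (neighbourIn v i))

  size-inU : ∀ i → Boxes.size (inU G part) i ≡ sizeU G part i
  size-inU i = sym (count≡sum (inU G part i))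

  nonEdges : Fin r → Fin r → ℕ
  nonEdges i j = sum (λ u → χ (inU G part i u) * sum (λ w → χ (inU G part j w) * χ (not (adj G u w))))

  nonEdges+eU : ∀ i j → nonEdges i j + eU G part i j ≡ sizeU G part i * sizeU G part j
  nonEdges+eU i j = begin
    nonEdges i j + eU G part i j
      ≡⟨ cong (nonEdges i j +_) (trans (sumFin≡sum {N G} _) (sum-cong-≗ edgesAt)) ⟩
    sum (λ u → χ (U i u) * nonNeighbours u) + sum (λ u → χ (U i u) * neighbours u)
      ≡⟨ ∑-distrib-+ {N G} _ _ ⟨
    sum (λ u → χ (U i u) * nonNeighbours u + χ (U i u) * neighbours u)
      ≡⟨ sum-cong-≗ (λ u → trans (sym (*-distribˡ-+ (χ (U i u)) _ _)) (cong (χ (U i u) *_) (partition u))) ⟩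
    sum (λ u → χ (U i u) * sizeU G part j)
      ≡⟨ *-distribʳ-sum (sizeU G part j) (χ ∘ U i) ⟨
    sum (χ ∘ U i) * sizeU G part j
      ≡⟨ cong (_* sizeU G part j) (count≡sum (U i)) ⟨
    sizeU G part i * sizeU G part j ∎
    where
    open ≡-Reasoning
    U = inU G part
    nonNeighbours neighbours : V → ℕ
    nonNeighbours u = sum (λ w → χ (U j w) * χ (not (adj G u w)))
    neighbours u = sum (λ w → χ (U j w ∧ adj G u w))
    edgesAt : ∀ u → (if U i u then count (λ w → U j w ∧ adj G u w) else 0) ≡ χ (U i u) * neighbours u
    edgesAt u with U i u
    ... | true  = trans (count≡sum (λ w → U j w ∧ adj G u w)) (sym (+-identityʳ _))
    ... | false = refl
    χ-partition : ∀ a b → χ a * χ (not b) + χ (a ∧ b) ≡ χ a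
    χ-partition true  true  = refl
    χ-partition true  false = refl
    χ-partition false b     = refl
    partition : ∀ u → nonNeighbours u + neighbours u ≡ sizeU G part j
    partition u = begin
      nonNeighbours u + neighbours u               ≡⟨ ∑-distrib-+ {N G} _ _ ⟨
      sum (λ w → χ (U j w) * χ (not (adj G u w)) + χ (U j w ∧ adj G u w))
                                                   ≡⟨ sum-cong-≗ (λ w → χ-partition (U j w) (adj G u w)) ⟩
      sum (χ ∘ U j)                                ≡⟨ count≡sum (U j) ⟨
      sizeU G part j                               ∎

  badPairs-same≤1 : ∀ A ℓ y → badPairs A ℓ ℓ y ≤ 1
  badPairs-same≤1 A ℓ y = begin
    sum (λ x → χ (A ℓ x) * χ (not (compatible ℓ x ℓ y)))
      ≤⟨ sum-mono-≤ (λ x → *-monoˡ-≤ _ (χ≤1 (A ℓ x))) ⟩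
    sum (λ x → 1 * χ (not (compatible ℓ x ℓ y)))
      ≡⟨ sum-cong-≗ (λ x → trans (*-identityˡ _)
           (cong χ (trans (cong not (compatible-same ℓ x y)) (not-involutive _)))) ⟩
    sum (λ x → χ (does (x ≟ y)))
      ≡⟨ sum-χ-≟ y ⟩
    1 ∎
    where open ≤-Reasoning

  badPairs-different : ∀ A {ℓ ℓ′} → ℓ ≢ ℓ′ → ∀ y →
    badPairs A ℓ ℓ′ y ≡ sum (λ x → χ (A ℓ x) * χ (not (adj G x y)))
  badPairs-different A ℓ≢ℓ′ y =
    sum-cong-≗ (λ x → cong (λ c → χ (A _ x) * χ (not c)) (compatible-different x y ℓ≢ℓ′))

  neighbourIn-badPairs≤nonEdges : ∀ v {ℓ ℓ′} → ℓ ≢ ℓ′ →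
    sum (λ y → χ (neighbourIn v ℓ′ y) * badPairs (neighbourIn v) ℓ ℓ′ y) ≤ nonEdges ℓ′ ℓ
  neighbourIn-badPairs≤nonEdges v {ℓ} {ℓ′} ℓ≢ℓ′ = sum-mono-≤ λ y →
    *-mono-≤ (χ-∧-≤ (inU G part ℓ′ y) (adj G v y)) (begin
      badPairs (neighbourIn v) ℓ ℓ′ y
        ≡⟨ badPairs-different (neighbourIn v) ℓ≢ℓ′ y ⟩
      sum (λ x → χ (neighbourIn v ℓ x) * χ (not (adj G x y)))
        ≤⟨ sum-mono-≤ (λ x → *-mono-≤ (χ-∧-≤ (inU G part ℓ x) (adj G v x))
                                      (≤-reflexive (cong (χ ∘ not) (Graph.sym G x y)))) ⟩
      sum (λ x → χ (inU G part ℓ x) * χ (not (adj G y x))) ∎)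
    where open ≤-Reasoning

  module Parts = Boxes (inU G part)
  module Neighbours (v : V) = Boxes (neighbourIn v)

  commonNeighbour : (V → Bool) → ∀ {k} → Vec (Fin r) k → Vec V k → V → Bool
  commonNeighbour X L T v = X v ∧ (Neighbours.inBox v L T ∧ pairwiseCompatible L T)

  count-commonNeighbour-≤ : ∀ s → ¬ ContainsKpart G (r + 1) (suc s) → (X : V → Bool) → ∀ T →
    count (commonNeighbour X (labels (suc s)) T) ≤ s * χ (Parts.inBox (labels (suc s)) T)
  count-commonNeighbour-≤ s no-Kpart X T = by-membership (Parts.inBox L T) refl
    where
    L = labels (suc s)
    P = commonNeighbour X L T

    P⇒inBox : ∀ v → P v ≡ true → Neighbours.inBox v L T ≡ true
    P⇒inBox v Pv = ∧-conicalˡ _ _ (∧-conicalʳ (X v) _ Pv)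

    at-most-s : count P ≤ s
    at-most-s = ≮⇒≥ λ s<count →
      let w , w-injective , Pw = ≤count⇒injection P (suc s) s<count in
      no-Kpart (common-neighbours⇒Kpart T
        (∧-conicalʳ _ _ (∧-conicalʳ (X (w zero)) _ (Pw zero))) w w-injective
        (λ a m → ∧-conicalʳ (inU G part (lookup L m) (lookup T m)) _
                   (Neighbours.inBox-lookup (w a) L T (P⇒inBox (w a) (Pw a)) m)))

    by-membership : ∀ u → Parts.inBox L T ≡ u → count P ≤ s * χ u
    by-membership true  _   = ≤-trans at-most-s (≤-reflexive (sym (*-identityʳ s)))
    by-membership false T∉U = ≤-trans (≮⇒≥ λ 0<count →
      let w , _ , Pw = ≤count⇒injection P 1 0<count in
      contradiction (trans (sym T∉U) (inBox-mono (neighbourIn (w zero)) (inU G part)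
                      (λ ℓ x → ∧-conicalˡ _ _) L T (P⇒inBox (w zero) (Pw zero)))) λ ()) z≤n

  sum-compatibleCount-≤ : ∀ s → ¬ ContainsKpart G (r + 1) (suc s) → (X : V → Bool) →
    sum (λ v → χ (X v) * compatibleCount (neighbourIn v) (labels (suc s))) ≤ s * Parts.boxSize (labels (suc s))
  sum-compatibleCount-≤ s no-Kpart X = begin
    sum (λ v → χ (X v) * tupleSum K (λ T → χ (Neighbours.inBox v L T ∧ pairwiseCompatible L T)))
      ≡⟨ sum-cong-≗ (λ v → *-distribˡ-tupleSum K (χ (X v)) _) ⟩
    sum (λ v → tupleSum K (λ T → χ (X v) * χ (Neighbours.inBox v L T ∧ pairwiseCompatible L T)))
      ≡⟨ tupleSum-sum-comm K _ ⟨
    tupleSum K (λ T → sum (λ v → χ (X v) * χ (Neighbours.inBox v L T ∧ pairwiseCompatible L T)))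
      ≡⟨ tupleSum-cong K (λ T → trans (sum-cong-≗ (λ v → sym (χ-∧ (X v) _)))
                                      (sym (count≡sum (commonNeighbour X L T)))) ⟩
    tupleSum K (λ T → count (commonNeighbour X L T))
      ≤⟨ tupleSum-mono-≤ K (count-commonNeighbour-≤ s no-Kpart X) ⟩
    tupleSum K (λ T → s * χ (Parts.inBox L T))
      ≡⟨ *-distribˡ-tupleSum K s _ ⟨
    s * tupleSum K (χ ∘ Parts.inBox L)
      ≡⟨ cong (s *_) (Parts.tupleSum-χ-inBox L) ⟩
    s * Parts.boxSize L ∎
    where
    open ≤-Reasoning
    K = r * suc s
    L = labels (suc s)

  module FixedRatios (p q a b : ℕ) .{{_ : NonZero p}} .{{_ : NonZero q}} .{{_ : NonZero a}} .{{_ : NonZero b}}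
    (dense : ∀ i j → i ≢ j → b * (sizeU G part i * sizeU G part j) ≤ a * (sizeU G part i * sizeU G part j) + b * eU G part i j)
    where

    D c : ℕ
    D = b * p * p
    c = a * q * q

    instance
      D≢0 : NonZero D
      D≢0 = m*n≢0 (b * p) p {{m*n≢0 b p}}
      c≢0 : NonZero c
      c≢0 = m*n≢0 (a * q) q {{m*n≢0 a q}}

    nonEdges-bound : ∀ i j → i ≢ j → b * nonEdges i j ≤ a * (sizeU G part i * sizeU G part j)
    nonEdges-bound i j i≢j = +-cancelʳ-≤ (b * eU G part i j) _ _ (begin
      b * nonEdges i j + b * eU G part i j  ≡⟨ *-distribˡ-+ b (nonEdges i j) _ ⟨
      b * (nonEdges i j + eU G part i j)    ≡⟨ cong (b *_) (nonEdges+eU i j) ⟩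
      b * (sizeU G part i * sizeU G part j) ≤⟨ dense i j i≢j ⟩
      a * (sizeU G part i * sizeU G part j) + b * eU G part i j ∎)
      where open ≤-Reasoning

    module _ (v : V) (rich : ∀ i → p * sizeU G part i ≤ q * degU G part v i) (large : ∀ i → D ≤ degU G part v i) where

      private
        d : Fin r → ℕ
        d = Neighbours.size v

        rich′ : ∀ i → p * Parts.size i ≤ q * d i
        rich′ i = subst₂ (λ m n → p * m ≤ q * n) (sym (size-inU i)) (sym (size-neighbourIn v i)) (rich i)

        large′ : ∀ i → D ≤ d i
        large′ i = subst (D ≤_) (sym (size-neighbourIn v i)) (large i)

      few-badPairs-same : ∀ ℓ →
        D * sum (λ y → χ (neighbourIn v ℓ y) * badPairs (neighbourIn v) ℓ ℓ y) ≤ c * d ℓ * d ℓ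
      few-badPairs-same ℓ = begin
        D * sum (λ y → χ (neighbourIn v ℓ y) * badPairs (neighbourIn v) ℓ ℓ y)
          ≤⟨ *-monoʳ-≤ D (sum-mono-≤ (λ y →
               ≤-trans (*-monoʳ-≤ (χ (neighbourIn v ℓ y)) (badPairs-same≤1 (neighbourIn v) ℓ y))
                       (≤-reflexive (*-identityʳ _)))) ⟩
        D * d ℓ             ≤⟨ *-monoˡ-≤ (d ℓ) (large′ ℓ) ⟩
        d ℓ * d ℓ           ≤⟨ m≤n*m (d ℓ * d ℓ) c ⟩
        c * (d ℓ * d ℓ)     ≡⟨ *-assoc c (d ℓ) (d ℓ) ⟨
        c * d ℓ * d ℓ       ∎
        where open ≤-Reasoning

      few-badPairs-different : ∀ {ℓ ℓ′} → ℓ ≢ ℓ′ →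
        D * sum (λ y → χ (neighbourIn v ℓ′ y) * badPairs (neighbourIn v) ℓ ℓ′ y) ≤ c * d ℓ * d ℓ′
      few-badPairs-different {ℓ} {ℓ′} ℓ≢ℓ′ = begin
        D * sum (λ y → χ (neighbourIn v ℓ′ y) * badPairs (neighbourIn v) ℓ ℓ′ y)
          ≤⟨ *-monoʳ-≤ D (neighbourIn-badPairs≤nonEdges v ℓ≢ℓ′) ⟩
        b * p * p * nonEdges ℓ′ ℓ                       ≡⟨ shuffle₁ b p (nonEdges ℓ′ ℓ) ⟩
        p * p * (b * nonEdges ℓ′ ℓ)                     ≤⟨ *-monoʳ-≤ (p * p) (nonEdges-bound ℓ′ ℓ (ℓ≢ℓ′ ∘ sym)) ⟩
        p * p * (a * (sizeU G part ℓ′ * sizeU G part ℓ)) ≡⟨ shuffle₂ p a (sizeU G part ℓ′) (sizeU G part ℓ) ⟩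
        a * ((p * sizeU G part ℓ′) * (p * sizeU G part ℓ))
                                                        ≤⟨ *-monoʳ-≤ a (*-mono-≤ (rich ℓ′) (rich ℓ)) ⟩
        a * ((q * degU G part v ℓ′) * (q * degU G part v ℓ))
                                                        ≡⟨ shuffle₃ a q (degU G part v ℓ′) (degU G part v ℓ) ⟩
        c * degU G part v ℓ * degU G part v ℓ′          ≡⟨ cong₂ (λ m n → c * m * n)
                                                             (size-neighbourIn v ℓ) (size-neighbourIn v ℓ′) ⟨
        c * d ℓ * d ℓ′                                  ∎
        where
        open ≤-Reasoning
        shuffle₁ : ∀ b p x → b * p * p * x ≡ p * p * (b * x)
        shuffle₁ = solve-∀
        shuffle₂ : ∀ p a x y → p * p * (a * (x * y)) ≡ a * ((p * x) * (p * y))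
        shuffle₂ = solve-∀
        shuffle₃ : ∀ a q x y → a * ((q * x) * (q * y)) ≡ a * q * q * y * x
        shuffle₃ = solve-∀

      few-badPairs : FewBadPairs (neighbourIn v) D c
      few-badPairs ℓ ℓ′ = case ℓ ≟ ℓ′ of λ where
        (yes refl) → few-badPairs-same ℓ
        (no ℓ≢ℓ′)  → few-badPairs-different ℓ≢ℓ′

      compatibleCount-≥ : ∀ {k} (L : Vec (Fin r) k) → 3 * (k * k * c) ≤ D →
        2 * (p ^ k * Parts.boxSize L) ≤ 3 * (q ^ k * compatibleCount (neighbourIn v) L)
      compatibleCount-≥ {k} L 3k²c≤D = begin
        2 * (p ^ k * Parts.boxSize L)                   ≤⟨ *-monoʳ-≤ 2 (^*boxSize-mono-≤ (inU G part) (neighbourIn v) p q rich′ L) ⟩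
        2 * (q ^ k * Neighbours.boxSize v L)            ≡⟨ *-comm-middle 2 (q ^ k) _ ⟩
        q ^ k * (2 * Neighbours.boxSize v L)            ≤⟨ *-monoʳ-≤ (q ^ k)
                                                             (2*boxSize≤3*compatibleCount (neighbourIn v) D c few-badPairs L 3k²c≤D) ⟩
        q ^ k * (3 * compatibleCount (neighbourIn v) L) ≡⟨ *-comm-middle (q ^ k) 3 _ ⟩
        3 * (q ^ k * compatibleCount (neighbourIn v) L) ∎
        where
        open ≤-Reasoning
        *-comm-middle : ∀ a b c → a * (b * c) ≡ b * (a * c)
        *-comm-middle = solve-∀

    count*boxSize≤sum-compatibleCount : ∀ {k} (L : Vec (Fin r) k) → 3 * (k * k * c) ≤ D →
      (∀ i → q * D ≤ sizeU G part i) →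
      (X : V → Bool) → (∀ v → X v ≡ true → ∀ i → p * sizeU G part i ≤ q * degU G part v i) →
      count X * (2 * (p ^ k * Parts.boxSize L)) ≤ 3 * q ^ k * sum (λ v → χ (X v) * compatibleCount (neighbourIn v) L)
    count*boxSize≤sum-compatibleCount {k} L 3k²c≤D qD≤sizeU X X-rich = begin
      count X * B                                ≡⟨ cong (_* B) (count≡sum X) ⟩
      sum (χ ∘ X) * B                            ≡⟨ *-distribʳ-sum B (χ ∘ X) ⟩
      sum (λ v → χ (X v) * B)                    ≤⟨ sum-mono-≤ per-vertex ⟩
      sum (λ v → 3 * q ^ k * (χ (X v) * compatibleCount (neighbourIn v) L))
                                                 ≡⟨ *-distribˡ-sum (3 * q ^ k) (λ v → χ (X v) * compatibleCount (neighbourIn v) L) ⟨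
      3 * q ^ k * sum (λ v → χ (X v) * compatibleCount (neighbourIn v) L) ∎
      where
      open ≤-Reasoning
      B = 2 * (p ^ k * Parts.boxSize L)
      per-vertex : ∀ v → χ (X v) * B ≤ 3 * q ^ k * (χ (X v) * compatibleCount (neighbourIn v) L)
      per-vertex v with X v in v∈X
      ... | false = z≤n
      ... | true  = begin
        1 * B                                               ≡⟨ *-identityˡ B ⟩
        B                                                   ≤⟨ compatibleCount-≥ v (X-rich v v∈X) large L 3k²c≤D ⟩
        3 * (q ^ k * compatibleCount (neighbourIn v) L)     ≡⟨ reassociate (q ^ k) _ ⟩
        3 * q ^ k * (1 * compatibleCount (neighbourIn v) L) ∎
        where
        large : ∀ i → D ≤ degU G part v i
        large i = *-cancelˡ-≤ q (begin
          q * D                ≤⟨ qD≤sizeU i ⟩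
          sizeU G part i       ≤⟨ m≤n*m (sizeU G part i) p ⟩
          p * sizeU G part i   ≤⟨ X-rich v v∈X i ⟩
          q * degU G part v i  ∎)
        reassociate : ∀ x y → 3 * (x * y) ≡ 3 * x * (1 * y)
        reassociate = solve-∀

    rich-vertices-bound : ∀ s n → q * D ≤ n →
      3 * r * r * suc s * suc s * a * (q * q) ≤ p * p * b →
      ¬ ContainsKpart G (r + 1) (suc s) →
      (∀ i → n ≤ sizeU G part i) →
      (X : V → Bool) → (∀ v → X v ≡ true → ∀ i → p * sizeU G part i ≤ q * degU G part v i) →
      count X * p ^ (r * suc s) ≤ 2 * s * q ^ (r * suc s)
    rich-vertices-bound s n qD≤n threshold no-Kpart large-parts X X-rich =
      *-cancelˡ-≤ 2 (≤-trans (*-cancelʳ-≤ _ _ P (begin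
        2 * (count X * p ^ K) * P     ≡⟨ regroup (count X) (p ^ K) P ⟩
        count X * (2 * (p ^ K * P))   ≤⟨ count*boxSize≤sum-compatibleCount L 3K²c≤D qD≤sizeU X X-rich ⟩
        3 * q ^ K * sum (λ v → χ (X v) * compatibleCount (neighbourIn v) L)
                                      ≤⟨ *-monoʳ-≤ (3 * q ^ K) (sum-compatibleCount-≤ s no-Kpart X) ⟩
        3 * q ^ K * (s * P)           ≡⟨ reassociate (q ^ K) s P ⟩
        3 * (q ^ K * s) * P           ∎))
        (≤-trans (*-monoˡ-≤ (q ^ K * s) (m≤n+m 3 1)) (≤-reflexive (double (q ^ K) s))))
      where
      open ≤-Reasoning
      K = r * suc s
      L = labels (suc s)
      P = Parts.boxSize L

      3K²c≤D : 3 * (K * K * c) ≤ D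
      3K²c≤D = subst₂ _≤_ (regroupˡ r (suc s) a q) (regroupʳ p b) threshold
        where
        regroupˡ : ∀ r t a q → 3 * r * r * t * t * a * (q * q) ≡ 3 * (r * t * (r * t) * (a * q * q))
        regroupˡ = solve-∀
        regroupʳ : ∀ p b → p * p * b ≡ b * p * p
        regroupʳ = solve-∀

      qD≤sizeU : ∀ i → q * D ≤ sizeU G part i
      qD≤sizeU i = ≤-trans qD≤n (large-parts i)

      instance
        P≢0 : NonZero P
        P≢0 = >-nonZero (Parts.boxSize-positive (λ i →
          ≤-trans (>-nonZero⁻¹ (q * D) {{m*n≢0 q D}}) (≤-trans (qD≤sizeU i) (≤-reflexive (sym (size-inU i))))) L)

      regroup : ∀ x y P → 2 * (x * y) * P ≡ x * (2 * (y * P))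
      regroup = solve-∀
      reassociate : ∀ x s P → 3 * x * (s * P) ≡ 3 * (x * s) * P
      reassociate = solve-∀
      double : ∀ x s → 4 * (x * s) ≡ 2 * (2 * s * x)
      double = solve-∀

module Fractions where

  open import Defs using (_^ℚ_)
  open import Data.Nat as ℕ using (ℕ; zero; suc; NonZero)
  import Data.Nat.Properties as ℕ
  import Data.Nat.Coprimality as Coprime
  open import Data.Integer as ℤ using (ℤ; +_; +0; +[1+_]; -[1+_]; +≤+)
  import Data.Integer.Properties as ℤ
  open import Data.Integer.Tactic.RingSolver using (solve-∀)
  open import Data.Rational.Unnormalised as ℚᵘ using (ℚᵘ; mkℚᵘ; ↥_; ↧_; ↧ₙ_; *≡*; *≤*)
  open import Data.Rational as ℚ using (ℚ; mkℚ; toℚᵘ; 0ℚ)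
  import Data.Rational.Properties as ℚ
  import Data.Rational.Unnormalised.Properties as ℚᵘ
  open import Data.Product using (Σ; _,_)
  open import Function using (_∘_; _$_)
  open import Relation.Nullary using (contradiction)
  open import Relation.Binary.PropositionalEquality

  infix 4 _≐ᵘ_/_ _≐_/_

  -- Stated on ℚᵘ, whose sums and products are not normalised, and transported to ℚ along toℚᵘ.
  record _≐ᵘ_/_ (x : ℚᵘ) (m n : ℕ) : Set where
    constructor cross
    field cross-multiplied : ↥ x ℤ.* + n ≡ + m ℤ.* ↧ x

  _≐_/_ : ℚ → ℕ → ℕ → Set
  x ≐ m / n = toℚᵘ x ≐ᵘ m / n

  private
    +-positive : ∀ n .{{_ : NonZero n}} → ℤ.Positive (+ n)
    +-positive (suc n) = _

    swap-middle : ∀ a b c d → (a ℤ.* b) ℤ.* (c ℤ.* d) ≡ (a ℤ.* c) ℤ.* (b ℤ.* d)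
    swap-middle = solve-∀

    swap-inner : ∀ a b c d → (a ℤ.* b) ℤ.* (c ℤ.* d) ≡ (a ℤ.* d) ℤ.* (b ℤ.* c)
    swap-inner = solve-∀

  ≐ᵘ-resp-≃ : ∀ {x y m n} → x ℚᵘ.≃ y → x ≐ᵘ m / n → y ≐ᵘ m / n
  ≐ᵘ-resp-≃ {x@(mkℚᵘ _ _)} {y@(mkℚᵘ _ _)} {m} {n} (*≡* x≃y) (cross x≐) = cross $
    ℤ.*-cancelʳ-≡ (↥ y ℤ.* + n) (+ m ℤ.* ↧ y) (↧ x) (begin
      ↥ y ℤ.* + n ℤ.* ↧ x     ≡⟨ swap-right (↥ y) (+ n) (↧ x) ⟩
      (↥ y ℤ.* ↧ x) ℤ.* + n   ≡⟨ cong (ℤ._* + n) x≃y ⟨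
      (↥ x ℤ.* ↧ y) ℤ.* + n   ≡⟨ swap-right (↥ x) (↧ y) (+ n) ⟩
      (↥ x ℤ.* + n) ℤ.* ↧ y   ≡⟨ cong (ℤ._* ↧ y) x≐ ⟩
      + m ℤ.* ↧ x ℤ.* ↧ y     ≡⟨ swap-right (+ m) (↧ x) (↧ y) ⟩
      + m ℤ.* ↧ y ℤ.* ↧ x     ∎)
    where
    open ≡-Reasoning
    swap-right : ∀ a b c → a ℤ.* b ℤ.* c ≡ a ℤ.* c ℤ.* b
    swap-right = solve-∀

  ≐ᵘ-* : ∀ {x y m n m′ n′} → x ≐ᵘ m / n → y ≐ᵘ m′ / n′ → x ℚᵘ.* y ≐ᵘ m ℕ.* m′ / (n ℕ.* n′)
  ≐ᵘ-* {x@(mkℚᵘ _ _)} {y@(mkℚᵘ _ _)} {m} {n} {m′} {n′} (cross x≐) (cross y≐) = cross $ begin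
    (↥ x ℤ.* ↥ y) ℤ.* + (n ℕ.* n′)       ≡⟨ cong ((↥ x ℤ.* ↥ y) ℤ.*_) (ℤ.pos-* n n′) ⟩
    (↥ x ℤ.* ↥ y) ℤ.* (+ n ℤ.* + n′)     ≡⟨ swap-middle (↥ x) (↥ y) (+ n) (+ n′) ⟩
    (↥ x ℤ.* + n) ℤ.* (↥ y ℤ.* + n′)     ≡⟨ cong₂ ℤ._*_ x≐ y≐ ⟩
    (+ m ℤ.* ↧ x) ℤ.* (+ m′ ℤ.* ↧ y)     ≡⟨ swap-middle (+ m) (↧ x) (+ m′) (↧ y) ⟩
    (+ m ℤ.* + m′) ℤ.* (↧ x ℤ.* ↧ y)     ≡⟨ cong₂ ℤ._*_ (ℤ.pos-* m m′) (ℤ.pos-* (↧ₙ x) (↧ₙ y)) ⟨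
    + (m ℕ.* m′) ℤ.* + (↧ₙ x ℕ.* ↧ₙ y)   ∎
    where open ≡-Reasoning

  ≐ᵘ-+ : ∀ {x y m n m′ n′} → x ≐ᵘ m / n → y ≐ᵘ m′ / n′ →
    x ℚᵘ.+ y ≐ᵘ m ℕ.* n′ ℕ.+ m′ ℕ.* n / (n ℕ.* n′)
  ≐ᵘ-+ {x@(mkℚᵘ _ _)} {y@(mkℚᵘ _ _)} {m} {n} {m′} {n′} (cross x≐) (cross y≐) = cross $ begin
    (↥ x ℤ.* ↧ y ℤ.+ ↥ y ℤ.* ↧ x) ℤ.* + (n ℕ.* n′)
      ≡⟨ cong ((↥ x ℤ.* ↧ y ℤ.+ ↥ y ℤ.* ↧ x) ℤ.*_) (ℤ.pos-* n n′) ⟩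
    (↥ x ℤ.* ↧ y ℤ.+ ↥ y ℤ.* ↧ x) ℤ.* (+ n ℤ.* + n′)
      ≡⟨ expand (↥ x) (↧ y) (↥ y) (↧ x) (+ n) (+ n′) ⟩
    (↥ x ℤ.* + n) ℤ.* (↧ y ℤ.* + n′) ℤ.+ (↥ y ℤ.* + n′) ℤ.* (↧ x ℤ.* + n)
      ≡⟨ cong₂ (λ u v → u ℤ.* (↧ y ℤ.* + n′) ℤ.+ v ℤ.* (↧ x ℤ.* + n)) x≐ y≐ ⟩
    (+ m ℤ.* ↧ x) ℤ.* (↧ y ℤ.* + n′) ℤ.+ (+ m′ ℤ.* ↧ y) ℤ.* (↧ x ℤ.* + n)
      ≡⟨ collect (+ m) (↧ x) (↧ y) (+ n′) (+ m′) (+ n) ⟩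
    (+ m ℤ.* + n′ ℤ.+ + m′ ℤ.* + n) ℤ.* (↧ x ℤ.* ↧ y)
      ≡⟨ cong₂ ℤ._*_ numerator (ℤ.pos-* (↧ₙ x) (↧ₙ y)) ⟨
    + (m ℕ.* n′ ℕ.+ m′ ℕ.* n) ℤ.* + (↧ₙ x ℕ.* ↧ₙ y) ∎
    where
    open ≡-Reasoning
    expand : ∀ a b c d e f →
      (a ℤ.* b ℤ.+ c ℤ.* d) ℤ.* (e ℤ.* f) ≡ (a ℤ.* e) ℤ.* (b ℤ.* f) ℤ.+ (c ℤ.* f) ℤ.* (d ℤ.* e)
    expand = solve-∀
    collect : ∀ a dx dy d c b →
      (a ℤ.* dx) ℤ.* (dy ℤ.* d) ℤ.+ (c ℤ.* dy) ℤ.* (dx ℤ.* b) ≡ (a ℤ.* d ℤ.+ c ℤ.* b) ℤ.* (dx ℤ.* dy)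
    collect = solve-∀
    numerator : + (m ℕ.* n′ ℕ.+ m′ ℕ.* n) ≡ + m ℤ.* + n′ ℤ.+ + m′ ℤ.* + n
    numerator = trans (ℤ.pos-+ (m ℕ.* n′) (m′ ℕ.* n)) (cong₂ ℤ._+_ (ℤ.pos-* m n′) (ℤ.pos-* m′ n))

  ≐ᵘ-≤ : ∀ {x y m n m′ n′} → x ≐ᵘ m / n → y ≐ᵘ m′ / n′ → x ℚᵘ.≤ y → m ℕ.* n′ ℕ.≤ m′ ℕ.* n
  ≐ᵘ-≤ {x@(mkℚᵘ _ _)} {y@(mkℚᵘ _ _)} {m} {n} {m′} {n′} (cross x≐) (cross y≐) (*≤* x≤y) =
    ℤ.drop‿+≤+ (ℤ.*-cancelʳ-≤-pos (+ (m ℕ.* n′)) (+ (m′ ℕ.* n)) (↧ x ℤ.* ↧ y) (begin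
      + (m ℕ.* n′) ℤ.* (↧ x ℤ.* ↧ y)      ≡⟨ cong (ℤ._* (↧ x ℤ.* ↧ y)) (ℤ.pos-* m n′) ⟩
      (+ m ℤ.* + n′) ℤ.* (↧ x ℤ.* ↧ y)    ≡⟨ swap-middle (+ m) (+ n′) (↧ x) (↧ y) ⟩
      (+ m ℤ.* ↧ x) ℤ.* (+ n′ ℤ.* ↧ y)    ≡⟨ cong (ℤ._* (+ n′ ℤ.* ↧ y)) x≐ ⟨
      (↥ x ℤ.* + n) ℤ.* (+ n′ ℤ.* ↧ y)    ≡⟨ swap-inner (↥ x) (+ n) (+ n′) (↧ y) ⟩
      (↥ x ℤ.* ↧ y) ℤ.* (+ n ℤ.* + n′)    ≡⟨ cong ((↥ x ℤ.* ↧ y) ℤ.*_) (ℤ.pos-* n n′) ⟨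
      (↥ x ℤ.* ↧ y) ℤ.* + (n ℕ.* n′)      ≤⟨ ℤ.*-monoʳ-≤-nonNeg (+ (n ℕ.* n′)) x≤y ⟩
      (↥ y ℤ.* ↧ x) ℤ.* + (n ℕ.* n′)      ≡⟨ cong ((↥ y ℤ.* ↧ x) ℤ.*_) (trans (ℤ.pos-* n n′) (ℤ.*-comm (+ n) (+ n′))) ⟩
      (↥ y ℤ.* ↧ x) ℤ.* (+ n′ ℤ.* + n)    ≡⟨ swap-inner (↥ y) (+ n′) (+ n) (↧ x) ⟨
      (↥ y ℤ.* + n′) ℤ.* (+ n ℤ.* ↧ x)    ≡⟨ cong (ℤ._* (+ n ℤ.* ↧ x)) y≐ ⟩
      (+ m′ ℤ.* ↧ y) ℤ.* (+ n ℤ.* ↧ x)    ≡⟨ swap-middle (+ m′) (+ n) (↧ y) (↧ x) ⟨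
      (+ m′ ℤ.* + n) ℤ.* (↧ y ℤ.* ↧ x)    ≡⟨ cong₂ ℤ._*_ (ℤ.pos-* m′ n) (ℤ.*-comm (↧ x) (↧ y)) ⟨
      + (m′ ℕ.* n) ℤ.* (↧ x ℤ.* ↧ y)      ∎))
    where open ℤ.≤-Reasoning

  ≤-≐ᵘ : ∀ {x y m n m′ n′} .{{_ : NonZero n}} .{{_ : NonZero n′}} →
    x ≐ᵘ m / n → y ≐ᵘ m′ / n′ → m ℕ.* n′ ℕ.≤ m′ ℕ.* n → x ℚᵘ.≤ y
  ≤-≐ᵘ {x@(mkℚᵘ _ _)} {y@(mkℚᵘ _ _)} {m} {n} {m′} {n′} (cross x≐) (cross y≐) mn′≤m′n =
    *≤* (ℤ.*-cancelʳ-≤-pos (↥ x ℤ.* ↧ y) (↥ y ℤ.* ↧ x) (+ (n ℕ.* n′))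
           {{+-positive (n ℕ.* n′) {{ℕ.m*n≢0 n n′}}}} (begin
      (↥ x ℤ.* ↧ y) ℤ.* + (n ℕ.* n′)      ≡⟨ cong ((↥ x ℤ.* ↧ y) ℤ.*_) (ℤ.pos-* n n′) ⟩
      (↥ x ℤ.* ↧ y) ℤ.* (+ n ℤ.* + n′)    ≡⟨ swap-inner (↥ x) (+ n) (+ n′) (↧ y) ⟨
      (↥ x ℤ.* + n) ℤ.* (+ n′ ℤ.* ↧ y)    ≡⟨ cong (ℤ._* (+ n′ ℤ.* ↧ y)) x≐ ⟩
      (+ m ℤ.* ↧ x) ℤ.* (+ n′ ℤ.* ↧ y)    ≡⟨ swap-middle (+ m) (↧ x) (+ n′) (↧ y) ⟩
      (+ m ℤ.* + n′) ℤ.* (↧ x ℤ.* ↧ y)    ≡⟨ cong (ℤ._* (↧ x ℤ.* ↧ y)) (ℤ.pos-* m n′) ⟨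
      + (m ℕ.* n′) ℤ.* (↧ x ℤ.* ↧ y)      ≤⟨ ℤ.*-monoʳ-≤-nonNeg (↧ x ℤ.* ↧ y) (+≤+ mn′≤m′n) ⟩
      + (m′ ℕ.* n) ℤ.* (↧ x ℤ.* ↧ y)      ≡⟨ cong (ℤ._* (↧ x ℤ.* ↧ y)) (ℤ.pos-* m′ n) ⟩
      (+ m′ ℤ.* + n) ℤ.* (↧ x ℤ.* ↧ y)    ≡⟨ swap-inner (+ m′) (+ n) (↧ x) (↧ y) ⟩
      (+ m′ ℤ.* ↧ y) ℤ.* (+ n ℤ.* ↧ x)    ≡⟨ cong (ℤ._* (+ n ℤ.* ↧ x)) y≐ ⟨
      (↥ y ℤ.* + n′) ℤ.* (+ n ℤ.* ↧ x)    ≡⟨ swap-inner (↥ y) (+ n′) (+ n) (↧ x) ⟩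
      (↥ y ℤ.* ↧ x) ℤ.* (+ n′ ℤ.* + n)    ≡⟨ cong ((↥ y ℤ.* ↧ x) ℤ.*_) (trans (ℤ.*-comm (+ n′) (+ n)) (sym (ℤ.pos-* n n′))) ⟩
      (↥ y ℤ.* ↧ x) ℤ.* + (n ℕ.* n′)      ∎))
    where open ℤ.≤-Reasoning

  ≐-* : ∀ {x y m n m′ n′} → x ≐ m / n → y ≐ m′ / n′ → x ℚ.* y ≐ m ℕ.* m′ / (n ℕ.* n′)
  ≐-* {x} {y} x≐ y≐ = ≐ᵘ-resp-≃ (ℚᵘ.≃-sym (ℚ.toℚᵘ-homo-* x y)) (≐ᵘ-* x≐ y≐)

  ≐-+ : ∀ {x y m n m′ n′} → x ≐ m / n → y ≐ m′ / n′ → x ℚ.+ y ≐ m ℕ.* n′ ℕ.+ m′ ℕ.* n / (n ℕ.* n′)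
  ≐-+ {x} {y} x≐ y≐ = ≐ᵘ-resp-≃ (ℚᵘ.≃-sym (ℚ.toℚᵘ-homo-+ x y)) (≐ᵘ-+ x≐ y≐)

  ≐-^ : ∀ {x m n} → x ≐ m / n → ∀ k → x ^ℚ k ≐ m ℕ.^ k / (n ℕ.^ k)
  ≐-^ x≐ zero    = cross refl
  ≐-^ x≐ (suc k) = ≐-* x≐ (≐-^ x≐ k)

  ≐-fromℕ : ∀ n → + n ℚ./ 1 ≐ n / 1
  ≐-fromℕ n = subst (_≐ n / 1) (sym (ℚ.↥p/↧p≡p (mkℚ (+ n) 0 (Coprime.sym (Coprime.1-coprimeTo n)))))
                    (cross refl)

  ≐-≤ : ∀ {x y m n m′ n′} → x ≐ m / n → y ≐ m′ / n′ → x ℚ.≤ y → m ℕ.* n′ ℕ.≤ m′ ℕ.* n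
  ≐-≤ x≐ y≐ = ≐ᵘ-≤ x≐ y≐ ∘ ℚ.toℚᵘ-mono-≤

  ≤-≐ : ∀ {x y m n m′ n′} .{{_ : NonZero n}} .{{_ : NonZero n′}} →
    x ≐ m / n → y ≐ m′ / n′ → m ℕ.* n′ ℕ.≤ m′ ℕ.* n → x ℚ.≤ y
  ≤-≐ x≐ y≐ = ℚ.toℚᵘ-cancel-≤ ∘ ≤-≐ᵘ x≐ y≐

  positive⇒fraction : ∀ {x} → 0ℚ ℚ.< x → Σ ℕ λ m → Σ ℕ λ n → x ≐ suc m / suc n
  positive⇒fraction {mkℚ +[1+ m ] n _} _ = m , n , cross refl
  positive⇒fraction {mkℚ +0 _ _}        (ℚ.*<* 0<0) = contradiction 0<0 (ℤ.<-irrefl refl)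
  positive⇒fraction {mkℚ -[1+ _ ] _ _}  (ℚ.*<* ())

module ClearedHypotheses where

  open Fractions
  open import Defs using (N; inX; sizeU; degU; _^ℚ_)
  open import Data.Bool using (true)
  open import Data.Bool.Properties using (T-≡)
  open import Data.Nat as ℕ using (ℕ; NonZero)
  import Data.Nat.Properties as ℕ
  open import Data.Nat.Tactic.RingSolver using (solve-∀)
  open import Data.Fin using (Fin)
  open import Data.Integer using (+_)
  open import Data.Rational using (_/_; _<_; _≤_; _*_; _+_; _-_; 1ℚ)
  open import Data.Rational.Properties using (<⇒≤; +-monoˡ-≤; module ≤-Reasoning)
  open import Data.Rational.Solver using (module +-*-Solver)
  open import Function.Bundles using (Equivalence)
  open import Relation.Nullary.Decidable using (toWitness)
  open import Relation.Binary.PropositionalEquality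

  cleared-threshold : ∀ {γ ε a b p q} M → γ ≐ a / b → ε ≐ p / q →
    (+ M / 1) * γ < ε * ε → M ℕ.* a ℕ.* (q ℕ.* q) ℕ.≤ p ℕ.* p ℕ.* b
  cleared-threshold {a = a} {b} {p} {q} M γ≐ ε≐ Mγ<ε² =
    subst (M ℕ.* a ℕ.* (q ℕ.* q) ℕ.≤_) (cong (p ℕ.* p ℕ.*_) (ℕ.*-identityˡ b))
      (≐-≤ (≐-* (≐-fromℕ M) γ≐) (≐-* ε≐ ε≐) (<⇒≤ Mγ<ε²))

  cleared-density : ∀ {γ a b} u e → γ ≐ a / b →
    (1ℚ - γ) * (+ u / 1) ≤ + e / 1 → b ℕ.* u ℕ.≤ a ℕ.* u ℕ.+ b ℕ.* e
  cleared-density {γ} {a} {b} u e γ≐ dense =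
    subst₂ ℕ._≤_ (rearrangeˡ u b) (rearrangeʳ e b a u)
      (≐-≤ (≐-fromℕ u) (≐-+ (≐-fromℕ e) (≐-* γ≐ (≐-fromℕ u))) (begin
        + u / 1                                   ≡⟨ solve 2 (λ g x → x := (con 1ℚ :- g) :* x :+ g :* x)
                                                             refl γ (+ u / 1) ⟩
        (1ℚ - γ) * (+ u / 1) + γ * (+ u / 1)      ≤⟨ +-monoˡ-≤ (γ * (+ u / 1)) dense ⟩
        + e / 1 + γ * (+ u / 1)                   ∎))
    where
    open ≤-Reasoning
    open +-*-Solver
    rearrangeˡ : ∀ u b → u ℕ.* (1 ℕ.* (b ℕ.* 1)) ≡ b ℕ.* u
    rearrangeˡ = solve-∀
    rearrangeʳ : ∀ e b a u → (e ℕ.* (b ℕ.* 1) ℕ.+ a ℕ.* u ℕ.* 1) ℕ.* 1 ≡ a ℕ.* u ℕ.+ b ℕ.* e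
    rearrangeʳ = solve-∀

  cleared-degree : ∀ {ε p q} s d → ε ≐ p / q → ε * (+ s / 1) ≤ + d / 1 → p ℕ.* s ℕ.≤ q ℕ.* d
  cleared-degree {p = p} {q} s d ε≐ εs≤d =
    subst₂ ℕ._≤_ (ℕ.*-identityʳ (p ℕ.* s)) (rearrange d q)
      (≐-≤ (≐-* ε≐ (≐-fromℕ s)) (≐-fromℕ d) εs≤d)
    where
    rearrange : ∀ d q → d ℕ.* (q ℕ.* 1) ≡ q ℕ.* d
    rearrange = solve-∀

  inX⇒cleared-degree : ∀ {ε p q} G {r} (part : Fin (N G) → Fin r) → ε ≐ p / q →
    ∀ v → inX G part ε v ≡ true → ∀ i → p ℕ.* sizeU G part i ℕ.≤ q ℕ.* degU G part v i
  inX⇒cleared-degree G part ε≐ v v∈X i =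
    cleared-degree (sizeU G part i) (degU G part v i) ε≐ (toWitness (Equivalence.from T-≡ v∈X) i)

  uncleared-bound : ∀ {ε p q} x y k .{{_ : NonZero q}} → ε ≐ p / q →
    x ℕ.* p ℕ.^ k ℕ.≤ y ℕ.* q ℕ.^ k → (+ x / 1) * (ε ^ℚ k) ≤ + y / 1
  uncleared-bound {q = q} x y k ε≐ xpᵏ≤yqᵏ =
    ≤-≐ {{ℕ.m*n≢0 1 (q ℕ.^ k) {{_}} {{ℕ.m^n≢0 q k}}}} (≐-* (≐-fromℕ x) (≐-^ ε≐ k)) (≐-fromℕ y)
      (subst₂ ℕ._≤_ (sym (ℕ.*-identityʳ _)) (cong (y ℕ.*_) (sym (ℕ.*-identityˡ _))) xpᵏ≤yqᵏ)

open import Defs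
open import Data.Nat using (ℕ; _≥_)
open import Data.Fin using (Fin)
open import Data.Integer using (+_)
open import Data.Rational using (ℚ; _/_; _<_; _≤_; _*_; _-_; 0ℚ; 1ℚ)
open import Data.Product using (Σ)
open import Relation.Nullary using (¬_)
open import Relation.Binary.PropositionalEquality using (_≢_)
open import Data.Nat using () renaming (_+_ to _+ℕ_; _*_ to _*ℕ_; _∸_ to _∸ℕ_)
open import Data.Nat using (zero; suc)
open import Data.Product using (_,_)
open Fractions using (positive⇒fraction)
open ClearedHypotheses

proposition3p6 :
    (r t : ℕ) → r ≥ 1 → t ≥ 1 →
    (γ ε : ℚ) → 0ℚ < γ → 0ℚ < ε →
    (+ (3 *ℕ r *ℕ r *ℕ t *ℕ t) / 1) * γ < ε * ε →
    Σ ℕ λ n₀ → (n : ℕ) → n ≥ n₀ →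
      (G : Graph) → (part : Fin (N G) → Fin r) →
      ¬ ContainsKpart G (r +ℕ 1) t →
      (∀ i → sizeU G part i ≥ n) →
      (∀ i j → i ≢ j →
        (1ℚ - γ) * (+ (sizeU G part i *ℕ sizeU G part j) / 1) ≤ (+ eU G part i j / 1)) →
      (+ count (inX G part ε) / 1) * (ε ^ℚ (r *ℕ t)) ≤ + (2 *ℕ (t ∸ℕ 1)) / 1
proposition3p6 r zero    _ () γ ε
proposition3p6 r (suc s) _ _  γ ε 0<γ 0<ε threshold =
  let a-1 , b-1 , γ≐ = positive⇒fraction 0<γ
      p-1 , q-1 , ε≐ = positive⇒fraction 0<ε
      a = suc a-1
      b = suc b-1
      p = suc p-1
      q = suc q-1
  in
  -- n₀ = q b p² makes |N(v) ∩ U_i| ≥ b p² for v ∈ X, which is what keeps coinciding entries rare.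
  q *ℕ (b *ℕ p *ℕ p) , λ n n≥n₀ G part no-Kpart large-parts dense →
    uncleared-bound (count (inX G part ε)) (2 *ℕ s) (r *ℕ suc s) ε≐
      (GraphTuples.FixedRatios.rich-vertices-bound G part p q a b
        (λ i j i≢j → cleared-density (sizeU G part i *ℕ sizeU G part j) (eU G part i j) γ≐ (dense i j i≢j))
        s n n≥n₀ (cleared-threshold (3 *ℕ r *ℕ r *ℕ suc s *ℕ suc s) γ≐ ε≐ threshold) no-Kpart large-parts
        (inX G part ε) (inX⇒cleared-degree G part ε≐))
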